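{- Let $G=(V,E)$ be a finite simple graph and let $Z$ be a minimum zero forcing set of $G$. Then for any $S\subseteq Z$, there does not exist a set $R\subseteq V$ with $|R|<|S|$ and $\mathrm{cl}(S)\subseteq \mathrm{cl}(R)$.
   Context: Zero forcing color change rule: given a set of colored vertices, a colored vertex with exactly one uncolored neighbor forces that neighbor to become colored. The closure $\mathrm{cl}(S)$ of $S\subseteq V$ is the set of colored vertices obtained by starting with exactly $S$ colored and applying the color change rule until no further vertex can be forced. A zero forcing set is a set $S$ with $\mathrm{cl}(S)=V$; a minimum zero forcing set is one of minimum cardinality, and this cardinality is the zero forcing number $Z(G)$. -}

module Defs where

open import Data.Nat using (ℕ; _≤_)
open import Data.Fin using (Fin)
open import Data.Fin.Subset using (Subset; _∈_; ∣_∣)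
open import Data.Product using (Σ; _×_)
open import Relation.Binary.PropositionalEquality using (_≡_)
open import Relation.Nullary using (¬_)

record SimpleGraph (n : ℕ) : Set₁ where
  field
    Adj     : Fin n → Fin n → Set
    sym     : ∀ {u v} → Adj u v → Adj v u
    irrefl  : ∀ {v} → ¬ Adj v v

open SimpleGraph public

-- Closure cl(S) under the zero forcing colour change rule: the set of vertices
-- coloured when starting from S and forcing until no more forces apply.
data Cl {n : ℕ} (G : SimpleGraph n) (S : Subset n) : Fin n → Set where
  init  : ∀ {v} → v ∈ S → Cl G S v
  force : ∀ {u v} → Cl G S u → Adj G u v →
          (∀ w → Adj G u w → ¬ (w ≡ v) → Cl G S w) → Cl G S v

ZeroForcingSet : {n : ℕ} → SimpleGraph n → Subset n → Set
ZeroForcingSet G S = ∀ v → Cl G S v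

MinimumZeroForcingSet : {n : ℕ} → SimpleGraph n → Subset n → Set
MinimumZeroForcingSet {n} G Z =
  ZeroForcingSet G Z × (∀ (T : Subset n) → ZeroForcingSet G T → ∣ Z ∣ ≤ ∣ T ∣)

-- Suppose Z is a minimum zero forcing set, S ⊆ Z, and R is smaller than S
-- with cl(S) ⊆ cl(R).  Replace S by R inside Z, i.e. consider the set
-- T = (Z ─ S) ∪ R.  Then
--   * T is again zero forcing: R ⊆ T gives cl(S) ⊆ cl(R) ⊆ cl(T), so every
--     vertex of Z lies in cl(T), and hence cl(Z) = V ⊆ cl(T);
--   * |T| ≤ |Z ─ S| + |R| = |Z| − |S| + |R| < |Z|,
-- contradicting the minimality of Z.
module Submission where

open import Defs
open import Data.Nat using (ℕ; _<_; _≤_; _+_; suc; z≤n; s≤s)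
open import Data.Nat.Properties
  using (<-irrefl; ≤-<-trans; +-suc; +-monoʳ-<; m≤n⇒m≤1+n; module ≤-Reasoning)
open import Data.Fin using (Fin)
open import Data.Fin.Subset using (Subset; _⊆_; _∈_; ∣_∣; _∪_; _─_; inside; outside)
open import Data.Fin.Subset.Properties
  using (_∈?_; p⊆p∪q; q⊆p∪q; x∈p∧x∉q⇒x∈p─q; drop-∷-⊆)
open import Data.Vec using ([]; _∷_)
open import Data.Vec.Base using (here)
open import Data.Product using (Σ; _×_; _,_)
open import Relation.Nullary using (¬_; yes; no)
open import Relation.Binary.PropositionalEquality using (_≡_; refl; cong; trans)

∣p∪q∣≤∣p∣+∣q∣ : ∀ {n} (p q : Subset n) → ∣ p ∪ q ∣ ≤ ∣ p ∣ + ∣ q ∣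
∣p∪q∣≤∣p∣+∣q∣ []            []            = z≤n
∣p∪q∣≤∣p∣+∣q∣ (outside ∷ p) (outside ∷ q) = ∣p∪q∣≤∣p∣+∣q∣ p q
∣p∪q∣≤∣p∣+∣q∣ (outside ∷ p) (inside  ∷ q)
  rewrite +-suc ∣ p ∣ ∣ q ∣ = s≤s (∣p∪q∣≤∣p∣+∣q∣ p q)
∣p∪q∣≤∣p∣+∣q∣ (inside  ∷ p) (outside ∷ q) = s≤s (∣p∪q∣≤∣p∣+∣q∣ p q)
∣p∪q∣≤∣p∣+∣q∣ (inside  ∷ p) (inside  ∷ q)
  rewrite +-suc ∣ p ∣ ∣ q ∣ = s≤s (m≤n⇒m≤1+n (∣p∪q∣≤∣p∣+∣q∣ p q))

∣p─q∣+∣q∣≡∣p∣ : ∀ {n} (p q : Subset n) → q ⊆ p → ∣ p ─ q ∣ + ∣ q ∣ ≡ ∣ p ∣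
∣p─q∣+∣q∣≡∣p∣ []      []            _   = refl
∣p─q∣+∣q∣≡∣p∣ (x ∷ p) (outside ∷ q) q⊆p with x
... | outside = ∣p─q∣+∣q∣≡∣p∣ p q (drop-∷-⊆ q⊆p)
... | inside  = cong suc (∣p─q∣+∣q∣≡∣p∣ p q (drop-∷-⊆ q⊆p))
∣p─q∣+∣q∣≡∣p∣ (x ∷ p) (inside  ∷ q) q⊆p with q⊆p here
... | here = trans (+-suc ∣ p ─ q ∣ ∣ q ∣) (cong suc (∣p─q∣+∣q∣≡∣p∣ p q (drop-∷-⊆ q⊆p)))

Cl-closed : ∀ {n} (G : SimpleGraph n) {A B : Subset n} →
            (∀ {v} → v ∈ A → Cl G B v) → ∀ {v} → Cl G A v → Cl G B v
Cl-closed G A⊆clB (init v∈A)      = A⊆clB v∈A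
Cl-closed G A⊆clB (force u adj k) =
  force (Cl-closed G A⊆clB u) adj (λ w uw w≢v → Cl-closed G A⊆clB (k w uw w≢v))

Cl-mono : ∀ {n} (G : SimpleGraph n) {A B : Subset n} → A ⊆ B → ∀ {v} → Cl G A v → Cl G B v
Cl-mono G A⊆B = Cl-closed G (λ v∈A → init (A⊆B v∈A))

exchange : ∀ {n} (Z S R : Subset n) → Subset n
exchange Z S R = (Z ─ S) ∪ R

exchange-zeroForcing : ∀ {n} (G : SimpleGraph n) (Z S R : Subset n) →
  ZeroForcingSet G Z → (∀ v → Cl G S v → Cl G R v) →
  ZeroForcingSet G (exchange Z S R)
exchange-zeroForcing G Z S R zfZ clS⊆clR v = Cl-closed G Z⊆clT (zfZ v)
  where
  Z⊆clT : ∀ {u} → u ∈ Z → Cl G (exchange Z S R) u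
  Z⊆clT {u} u∈Z with u ∈? S
  ... | yes u∈S = Cl-mono G (q⊆p∪q (Z ─ S) R) (clS⊆clR u (init u∈S))
  ... | no  u∉S = init (p⊆p∪q R (x∈p∧x∉q⇒x∈p─q u∈Z u∉S))

exchange-smaller : ∀ {n} (Z S R : Subset n) → S ⊆ Z → ∣ R ∣ < ∣ S ∣ →
  ∣ exchange Z S R ∣ < ∣ Z ∣
exchange-smaller Z S R S⊆Z ∣R∣<∣S∣ = begin-strict
  ∣ (Z ─ S) ∪ R ∣      ≤⟨ ∣p∪q∣≤∣p∣+∣q∣ (Z ─ S) R ⟩
  ∣ Z ─ S ∣ + ∣ R ∣    <⟨ +-monoʳ-< ∣ Z ─ S ∣ ∣R∣<∣S∣ ⟩
  ∣ Z ─ S ∣ + ∣ S ∣    ≡⟨ ∣p─q∣+∣q∣≡∣p∣ Z S S⊆Z ⟩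
  ∣ Z ∣                ∎
  where open ≤-Reasoning

lemma1 : ∀ {n : ℕ} (G : SimpleGraph n) (Z : Subset n) → MinimumZeroForcingSet G Z →
    ∀ (S : Subset n) → S ⊆ Z →
    ¬ (Σ (Subset n) λ R → (∣ R ∣ < ∣ S ∣) × (∀ (v : Fin n) → Cl G S v → Cl G R v))
lemma1 G Z (zfZ , minimal) S S⊆Z (R , ∣R∣<∣S∣ , clS⊆clR) =
  <-irrefl refl (≤-<-trans ∣Z∣≤∣T∣ ∣T∣<∣Z∣)
  where
  ∣Z∣≤∣T∣ : ∣ Z ∣ ≤ ∣ exchange Z S R ∣
  ∣Z∣≤∣T∣ = minimal (exchange Z S R) (exchange-zeroForcing G Z S R zfZ clS⊆clR)
  ∣T∣<∣Z∣ : ∣ exchange Z S R ∣ < ∣ Z ∣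
  ∣T∣<∣Z∣ = exchange-smaller Z S R S⊆Z ∣R∣<∣S∣
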